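{- Let $m \geq 8$. Then the number of elements $x \in A_m$ with $x^2 = 1$ and the number of elements $x \in S_m$ with $x^2=1$ are both divisible by $4$.
   Context: $S_m$ is the symmetric group on $\{1,\ldots,m\}$ and $A_m$ the alternating group. "Involutions" here are counted including the identity, i.e. one counts all elements $x$ with $x^2=1$. -}

module Defs where

open import Data.Nat using (ℕ; zero; suc; _<ᵇ_)

open import Data.Bool using (Bool; true; false; _∧_; not; _xor_)
open import Data.Fin using (Fin; toℕ; _≟_)
open import Data.List using (List; []; _∷_; map; concatMap; allFin; length; filterᵇ; foldr)
open import Data.Vec using (Vec; lookup)
import Data.Vec as V
open import Relation.Nullary.Decidable using (⌊_⌋)

allᵇ : {A : Set} → (A → Bool) → List A → Bool
allᵇ p = foldr (λ x b → p x ∧ b) true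

-- All maps Fin m → Fin m, encoded as vectors of their values (i ↦ lookup v i).
allVecs : (k m : ℕ) → List (Vec (Fin m) k)
allVecs zero    m = V.[] ∷ []
allVecs (suc k) m = concatMap (λ i → map (i V.∷_) (allVecs k m)) (allFin m)

allMaps : (m : ℕ) → List (Vec (Fin m) m)
allMaps m = allVecs m m

_==_ : {m : ℕ} → Fin m → Fin m → Bool
i == j = ⌊ i ≟ j ⌋

-- injective (equivalently bijective, since Fin m is finite): a permutation in S_m
isPerm : {m : ℕ} → Vec (Fin m) m → Bool
isPerm {m} v = allᵇ (λ i → allᵇ (λ j → not (lookup v i == lookup v j) ∨' (i == j)) (allFin m)) (allFin m)
  where
    _∨'_ : Bool → Bool → Bool
    true ∨' _ = true
    false ∨' b = b

isInvolution : {m : ℕ} → Vec (Fin m) m → Bool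
isInvolution {m} v = allᵇ (λ i → lookup v (lookup v i) == i) (allFin m)

inversionParity : {m : ℕ} → Vec (Fin m) m → Bool
inversionParity {m} v =
  foldr _xor_ false
    (concatMap (λ i → map (λ j → (toℕ i <ᵇ toℕ j) ∧ (toℕ (lookup v j) <ᵇ toℕ (lookup v i))) (allFin m)) (allFin m))

isEven : {m : ℕ} → Vec (Fin m) m → Bool
isEven v = not (inversionParity v)

-- S_m and A_m as lists of their (distinct) elements
Sym : (m : ℕ) → List (Vec (Fin m) m)
Sym m = filterᵇ isPerm (allMaps m)

Alt : (m : ℕ) → List (Vec (Fin m) m)
Alt m = filterᵇ isEven (Sym m)

involutionsS : ℕ → ℕ
involutionsS m = length (filterᵇ isInvolution (Sym m))

involutionsA : ℕ → ℕ
involutionsA m = length (filterᵇ isInvolution (Alt m))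

-- An involution of {0, …, m+1} either fixes 0, and is then an involution of the other m+1 points,
-- or exchanges 0 with some j+1, and is then determined by an involution of the remaining m points.
-- Fixing 0 adds no inversion, while the exchange changes the number of inversions by an odd amount,
-- so the numbers e m and o m of even and odd involutions satisfy
--   e (m+2) = e (m+1) + (m+1) o m,   o (m+2) = o (m+1) + (m+1) e m.
-- Since e and o are divisible by 4 at m = 8 and m = 9, they stay so for all larger m, and the
-- involutions of A_m and S_m number e m and e m + o m.

module Submission where

open import Algebra.Bundles using (CommutativeRing)
open import Algebra.Properties.CommutativeSemigroup using (interchange)
open import Data.Bool using (Bool; true; false; _∧_; not; _xor_; T; T?)
open import Data.Bool.Properties using (xor-∧-commutativeRing; T-∧; ∧-zeroʳ; ∧-identityʳ; not-involutive)
open import Data.Empty using (⊥)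
open import Data.Fin using (Fin; zero; suc; toℕ; punchIn; punchOut; _≟_)
open import Data.Fin.Properties using (suc-injective; punchIn-injective; punchIn-punchOut; punchInᵢ≢i)
open import Data.List using (List; []; _∷_; _++_; map; concatMap; foldr; filterᵇ; length; allFin)
open import Data.List.Properties using (map-∘; map-cong; map-tabulate; filter-++; length-++; length-tabulate)
open import Data.List.Membership.Propositional using (_∈_; find)
open import Data.List.Membership.Propositional.Properties
  using (∈-map⁺; ∈-map⁻; ∈-++⁺ˡ; ∈-++⁺ʳ; ∈-concatMap⁺; ∈-concatMap⁻; ∈-allFin; ∈-filter⁺; ∈-filter⁻)
open import Data.List.Membership.Propositional.Properties.WithK using (unique∧set⇒bag)
open import Data.List.Relation.Binary.BagAndSetEquality using (∼bag⇒↭)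
open import Data.List.Relation.Binary.Permutation.Propositional using (_↭_; ↭⇒↭ₛ)
open import Data.List.Relation.Binary.Permutation.Propositional.Properties using (map⁺; ↭-length)
import Data.List.Relation.Binary.Permutation.Setoid.Properties as Permₛ
open import Data.List.Relation.Unary.All as All using (All) renaming (_∷_ to _∷ₐ_)
import Data.List.Relation.Unary.All.Properties as All
import Data.List.Relation.Unary.Any as Any
open import Data.List.Relation.Unary.Any using (here; there)
open import Data.List.Relation.Unary.Unique.Propositional using (Unique; []; _∷_)
import Data.List.Relation.Unary.Unique.Propositional.Properties as Unique
open import Data.Nat using (ℕ; zero; suc; _+_; _*_; _≤_; _<ᵇ_)
open import Data.Nat.Divisibility using (_∣_; divides; ∣m∣n⇒∣m+n; ∣n⇒∣m*n)
open import Data.Nat.Properties using (+-suc; m≤n⇒∃[o]m+o≡n)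
open import Data.Product using (_×_; _,_; proj₁; proj₂; ∃)
open import Data.Unit using (tt)
import Data.Vec as Vec
open import Data.Vec using (Vec; lookup; head; insertAt) renaming ([] to []ᵥ; _∷_ to _∷ᵥ_)
open import Data.Vec.Properties
  using (lookup-map; lookup∘tabulate; tabulate∘lookup; tabulate-cong; insertAt-lookup; insertAt-punchIn; ∷-injectiveʳ)
open import Function using (_∘_; _⇔_; mk⇔; Equivalence)
open import Level using (Level)
open import Relation.Binary.PropositionalEquality
open import Relation.Nullary.Decidable using (yes; no; toWitness; fromWitness)

open import Defs

open ≡-Reasoning

private
  variable
    ℓ ℓ′ : Level
    A : Set ℓ
    B : Set ℓ′

module XorRing = CommutativeRing xor-∧-commutativeRing

parity : List Bool → Bool
parity = foldr _xor_ false

parity-++ : ∀ xs ys → parity (xs ++ ys) ≡ parity xs xor parity ys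
parity-++ []       ys = refl
parity-++ (x ∷ xs) ys = trans (cong (x xor_) (parity-++ xs ys)) (sym (XorRing.+-assoc x (parity xs) (parity ys)))

parity-↭ : ∀ {xs ys} → xs ↭ ys → parity xs ≡ parity ys
parity-↭ p = Permₛ.foldr-commMonoid (setoid Bool) XorRing.+-isCommutativeMonoid (↭⇒↭ₛ p)

parity-concatMap : (f : A → List Bool) (xs : List A) → parity (concatMap f xs) ≡ parity (map (parity ∘ f) xs)
parity-concatMap f []       = refl
parity-concatMap f (x ∷ xs) = trans (parity-++ (f x) (concatMap f xs)) (cong (parity (f x) xor_) (parity-concatMap f xs))

parity-map-false : {f : A → Bool} (xs : List A) → (∀ x → f x ≡ false) → parity (map f xs) ≡ false
parity-map-false []       f≡false = refl
parity-map-false (x ∷ xs) f≡false rewrite f≡false x = parity-map-false xs f≡false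

parity-map-xor : (f g : A → Bool) (xs : List A) → parity (map (λ x → f x xor g x) xs) ≡ parity (map f xs) xor parity (map g xs)
parity-map-xor f g []       = refl
parity-map-xor f g (x ∷ xs) =
  trans (cong ((f x xor g x) xor_) (parity-map-xor f g xs)) (interchange XorRing.+-commutativeSemigroup (f x) (g x) _ _)

parity-map-∘ : (f : B → Bool) (g : A → B) (xs : List A) → parity (map f (map g xs)) ≡ parity (map (f ∘ g) xs)
parity-map-∘ f g xs = cong parity (sym (map-∘ xs))

parity-map-cong : {f g : A → Bool} (xs : List A) → (∀ x → f x ≡ g x) → parity (map f xs) ≡ parity (map g xs)
parity-map-cong xs f≗g = cong parity (map-cong f≗g xs)

pairParity : (A → A → Bool) → List A → Bool
pairParity b L = parity (map (λ i → parity (map (b i) L)) L)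

pairParity-cong : {b c : A → A → Bool} (L : List A) → (∀ i j → b i j ≡ c i j) → pairParity b L ≡ pairParity c L
pairParity-cong L b≗c = parity-map-cong L (λ i → parity-map-cong L (b≗c i))

pairParity-↭ : (b : A → A → Bool) {L L′ : List A} → L ↭ L′ → pairParity b L ≡ pairParity b L′
pairParity-↭ b {L} L↭L′ = trans (parity-map-cong L (λ i → parity-↭ (map⁺ (b i) L↭L′))) (parity-↭ (map⁺ _ L↭L′))

pairParity-map : (g : A → B) (b : B → B → Bool) (L : List A) → pairParity b (map g L) ≡ pairParity (λ i j → b (g i) (g j)) L
pairParity-map g b L = trans (parity-map-∘ _ g L) (parity-map-cong L (λ i → parity-map-∘ (b (g i)) g L))

pairParity-∷ : (b : A → A → Bool) (x : A) (L : List A) →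
               pairParity b (x ∷ L) ≡ (b x x xor parity (map (b x) L)) xor (parity (map (λ i → b i x) L) xor pairParity b L)
pairParity-∷ b x L = cong ((b x x xor parity (map (b x) L)) xor_) (parity-map-xor (λ i → b i x) (λ i → parity (map (b i) L)) L)

unique∧set⇒↭ : {xs ys : List A} → Unique xs → Unique ys → (∀ {x} → x ∈ xs ⇔ x ∈ ys) → xs ↭ ys
unique∧set⇒↭ xs! ys! xs⇔ys = ∼bag⇒↭ (unique∧set⇒bag xs! ys! xs⇔ys)

unique∧set⇒length≡ : {xs ys : List A} → Unique xs → Unique ys → (∀ {x} → x ∈ xs ⇔ x ∈ ys) → length xs ≡ length ys
unique∧set⇒length≡ xs! ys! xs⇔ys = ↭-length (unique∧set⇒↭ xs! ys! xs⇔ys)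

Unique-concatMap⁺ : (f : A → List B) (key : B → A) → (∀ x {y} → y ∈ f x → key y ≡ x) →
             (∀ x → Unique (f x)) → {xs : List A} → Unique xs → Unique (concatMap f xs)
Unique-concatMap⁺ f key key-f f! {[]}     []          = []
Unique-concatMap⁺ f key key-f f! {x ∷ xs} (x∉xs ∷ xs!) = Unique.++⁺ (f! x) (Unique-concatMap⁺ f key key-f f! xs!) disjoint
  where
  disjoint : ∀ {y} → y ∈ f x × y ∈ concatMap f xs → ⊥
  disjoint (y∈fx , y∈rest) with find (∈-concatMap⁻ f {xs = xs} y∈rest)
  ... | x′ , x′∈xs , y∈fx′ = All.lookup x∉xs x′∈xs (trans (sym (key-f x y∈fx)) (key-f x′ y∈fx′))

length-filterᵇ-partition : (p : A → Bool) (xs : List A) →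
                           length xs ≡ length (filterᵇ p xs) + length (filterᵇ (not ∘ p) xs)
length-filterᵇ-partition p []       = refl
length-filterᵇ-partition p (x ∷ xs) with p x
... | true  = cong suc (length-filterᵇ-partition p xs)
... | false = trans (cong suc (length-filterᵇ-partition p xs)) (sym (+-suc _ _))

filterᵇ-cong : {p q : A → Bool} (xs : List A) → (∀ {x} → x ∈ xs → p x ≡ q x) → filterᵇ p xs ≡ filterᵇ q xs
filterᵇ-cong []       p≗q = refl
filterᵇ-cong {p = p} {q} (x ∷ xs) p≗q with p x | q x | p≗q (here refl)
... | true  | .true  | refl = cong (x ∷_) (filterᵇ-cong xs (p≗q ∘ there))
... | false | .false | refl = filterᵇ-cong xs (p≗q ∘ there)

length-filterᵇ-map : (p : B → Bool) (f : A → B) (xs : List A) → length (filterᵇ p (map f xs)) ≡ length (filterᵇ (p ∘ f) xs)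
length-filterᵇ-map p f []       = refl
length-filterᵇ-map p f (x ∷ xs) with p (f x)
... | true  = cong suc (length-filterᵇ-map p f xs)
... | false = length-filterᵇ-map p f xs

length-filterᵇ-concatMap : (p : B → Bool) (g : A → List B) (xs : List A) {c : ℕ} →
                           (∀ x → length (filterᵇ p (g x)) ≡ c) → length (filterᵇ p (concatMap g xs)) ≡ length xs * c
length-filterᵇ-concatMap p g []       hc = refl
length-filterᵇ-concatMap p g (x ∷ xs) hc = begin
  length (filterᵇ p (g x ++ concatMap g xs))                     ≡⟨ cong length (filter-++ _ (g x) (concatMap g xs)) ⟩
  length (filterᵇ p (g x) ++ filterᵇ p (concatMap g xs))         ≡⟨ length-++ (filterᵇ p (g x)) ⟩
  length (filterᵇ p (g x)) + length (filterᵇ p (concatMap g xs)) ≡⟨ cong₂ _+_ (hc x) (length-filterᵇ-concatMap p g xs hc) ⟩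
  _ ∎

lookup-ext : ∀ {n} {xs ys : Vec A n} → (∀ i → lookup xs i ≡ lookup ys i) → xs ≡ ys
lookup-ext {xs = xs} {ys} xs≗ys = trans (sym (tabulate∘lookup xs)) (trans (tabulate-cong xs≗ys) (tabulate∘lookup ys))

allVecs-complete : ∀ k m (v : Vec (Fin m) k) → v ∈ allVecs k m
allVecs-complete zero    m []ᵥ      = here refl
allVecs-complete (suc k) m (i ∷ᵥ w) =
  ∈-concatMap⁺ _ (Any.map (λ { refl → ∈-map⁺ (i ∷ᵥ_) (allVecs-complete k m w) }) (∈-allFin i))

allVecs-unique : ∀ k m → Unique (allVecs k m)
allVecs-unique zero    m = All.[] ∷ []
allVecs-unique (suc k) m =
  Unique-concatMap⁺ _ head head-∷ (λ i → Unique.map⁺ ∷-injectiveʳ (allVecs-unique k m)) (Unique.allFin⁺ m)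
  where
  head-∷ : ∀ i {v} → v ∈ map (i ∷ᵥ_) (allVecs k m) → head v ≡ i
  head-∷ i v∈ with ∈-map⁻ (i ∷ᵥ_) v∈
  ... | _ , _ , refl = refl

T-allᵇ⁻ : {p : A → Bool} (xs : List A) → T (allᵇ p xs) → ∀ {x} → x ∈ xs → T (p x)
T-allᵇ⁻ (y ∷ xs) all-p (here refl) = proj₁ (Equivalence.to T-∧ all-p)
T-allᵇ⁻ (y ∷ xs) all-p (there x∈)  = T-allᵇ⁻ xs (proj₂ (Equivalence.to T-∧ all-p)) x∈

T-allᵇ⁺ : {p : A → Bool} (xs : List A) → (∀ x → T (p x)) → T (allᵇ p xs)
T-allᵇ⁺ []       p-holds = tt
T-allᵇ⁺ (x ∷ xs) p-holds = Equivalence.from T-∧ (p-holds x , T-allᵇ⁺ xs p-holds)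

Involutive : ∀ {m} → Vec (Fin m) m → Set
Involutive v = ∀ i → lookup v (lookup v i) ≡ i

isInvolution⇔ : ∀ {m} (v : Vec (Fin m) m) → T (isInvolution v) ⇔ Involutive v
isInvolution⇔ {m} v = mk⇔
  (λ t i → toWitness (T-allᵇ⁻ (allFin m) t (∈-allFin i)))
  (λ inv → T-allᵇ⁺ (allFin m) (λ i → fromWitness (inv i)))

allᵇ-false⇒∃ : {p : A → Bool} (xs : List A) → allᵇ p xs ≡ false → ∃ λ x → p x ≡ false
allᵇ-false⇒∃ {p = p} (x ∷ xs) all-p with p x in px
... | true  = allᵇ-false⇒∃ xs all-p
... | false = x , px

involutive⇒injective : ∀ {m} (v : Vec (Fin m) m) → Involutive v → ∀ {i j} → lookup v i ≡ lookup v j → i ≡ j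
involutive⇒injective v inv {i} {j} vi≡vj = trans (sym (inv i)) (trans (cong (lookup v) vi≡vj) (inv j))

-- The disjunction in isPerm is local to its definition and cannot be named, so rather than proving
-- each entry we refute a failing one, whose equation with false has by then been reduced.
involutive⇒isPerm : ∀ {m} (v : Vec (Fin m) m) → Involutive v → T (isPerm v)
involutive⇒isPerm {m} v inv with isPerm v in perm
... | true  = tt
... | false with allᵇ-false⇒∃ (allFin m) perm
... | i , row with allᵇ-false⇒∃ (allFin m) row
... | j , entry with lookup v i ≟ lookup v j | i ≟ j
involutive⇒isPerm v inv | false | i , row | j , () | no _      | _
involutive⇒isPerm v inv | false | i , row | j , () | yes _     | yes _
involutive⇒isPerm v inv | false | i , row | j , _  | yes vi≡vj | no i≢j = i≢j (involutive⇒injective v inv vi≡vj)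

fixZero : ∀ {m} → Vec (Fin m) m → Vec (Fin (suc m)) (suc m)
fixZero w = zero ∷ᵥ Vec.map suc w

swapTail : ∀ {m} → Fin (suc m) → Vec (Fin m) m → Vec (Fin (suc (suc m))) (suc m)
swapTail j u = insertAt (Vec.map (suc ∘ punchIn j) u) j zero

-- swapZero j u exchanges 0 and suc j and acts as u on the remaining points, renumbered by suc ∘ punchIn j.
swapZero : ∀ {m} → Fin (suc m) → Vec (Fin m) m → Vec (Fin (suc (suc m))) (suc (suc m))
swapZero j u = suc j ∷ᵥ swapTail j u

involutionList : (m : ℕ) → List (Vec (Fin m) m)
involutionList zero          = []ᵥ ∷ []
involutionList (suc zero)    = (zero ∷ᵥ []ᵥ) ∷ []
involutionList (suc (suc m)) = map fixZero (involutionList (suc m)) ++ concatMap (λ j → map (swapZero j) (involutionList m)) (allFin (suc m))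

data PunchInView {m} (j : Fin (suc m)) : Fin (suc m) → Set where
  at-j    : PunchInView j j
  punched : (k : Fin m) → PunchInView j (punchIn j k)

punchInView : ∀ {m} (j p : Fin (suc m)) → PunchInView j p
punchInView j p with j ≟ p
... | yes refl = at-j
... | no j≢p   = subst (PunchInView j) (punchIn-punchOut j≢p) (punched (punchOut j≢p))

lookup-fixZero : ∀ {m} (w : Vec (Fin m) m) i → lookup (fixZero w) (suc i) ≡ suc (lookup w i)
lookup-fixZero w i = lookup-map i suc w

lookup-swapTail-j : ∀ {m} (j : Fin (suc m)) (u : Vec (Fin m) m) → lookup (swapTail j u) j ≡ zero
lookup-swapTail-j j u = insertAt-lookup (Vec.map (suc ∘ punchIn j) u) j zero

lookup-swapTail-punchIn : ∀ {m} (j : Fin (suc m)) (u : Vec (Fin m) m) k →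
                          lookup (swapTail j u) (punchIn j k) ≡ suc (punchIn j (lookup u k))
lookup-swapTail-punchIn j u k = trans (insertAt-punchIn (Vec.map (suc ∘ punchIn j) u) j zero k) (lookup-map k (suc ∘ punchIn j) u)

fixZero-involutive : ∀ {m} (w : Vec (Fin m) m) → Involutive w → Involutive (fixZero w)
fixZero-involutive w inv zero    = refl
fixZero-involutive w inv (suc i) = begin
  lookup (fixZero w) (lookup (fixZero w) (suc i)) ≡⟨ cong (lookup (fixZero w)) (lookup-fixZero w i) ⟩
  lookup (fixZero w) (suc (lookup w i))           ≡⟨ lookup-fixZero w (lookup w i) ⟩
  suc (lookup w (lookup w i))                     ≡⟨ cong suc (inv i) ⟩
  suc i                                           ∎

swapZero-involutive : ∀ {m} (j : Fin (suc m)) (u : Vec (Fin m) m) → Involutive u → Involutive (swapZero j u)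
swapZero-involutive j u inv zero = lookup-swapTail-j j u
swapZero-involutive j u inv (suc p) with punchInView j p
... | at-j      = cong (lookup (swapZero j u)) (lookup-swapTail-j j u)
... | punched k = begin
  lookup (swapZero j u) (lookup (swapZero j u) (suc (punchIn j k))) ≡⟨ cong (lookup (swapZero j u)) (lookup-swapTail-punchIn j u k) ⟩
  lookup (swapZero j u) (suc (punchIn j (lookup u k)))              ≡⟨ lookup-swapTail-punchIn j u (lookup u k) ⟩
  suc (punchIn j (lookup u (lookup u k)))                           ≡⟨ cong (suc ∘ punchIn j) (inv k) ⟩
  suc (punchIn j k)                                                 ∎

involutionList-involutive : ∀ m → All Involutive (involutionList m)
involutionList-involutive zero          = (λ ()) ∷ₐ All.[]
involutionList-involutive (suc zero)    = (λ { zero → refl }) ∷ₐ All.[]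
involutionList-involutive (suc (suc m)) = All.++⁺
  (All.map⁺ (All.map (λ {w} → fixZero-involutive w) (involutionList-involutive (suc m))))
  (All.concat⁺ (All.map⁺ (All.tabulate⁺ λ j → All.map⁺ (All.map (λ {u} → swapZero-involutive j u) (involutionList-involutive m)))))

fixZero-injective : ∀ {m} {w w′ : Vec (Fin m) m} → fixZero w ≡ fixZero w′ → w ≡ w′
fixZero-injective {w = w} {w′} eq = lookup-ext λ i →
  suc-injective (trans (sym (lookup-fixZero w i)) (trans (cong (λ v → lookup v (suc i)) eq) (lookup-fixZero w′ i)))

swapZero-injective : ∀ {m} (j : Fin (suc m)) {u u′ : Vec (Fin m) m} → swapZero j u ≡ swapZero j u′ → u ≡ u′
swapZero-injective j {u} {u′} eq = lookup-ext λ k → punchIn-injective j _ _ (suc-injective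
  (trans (sym (lookup-swapTail-punchIn j u k)) (trans (cong (λ v → lookup v (suc (punchIn j k))) eq) (lookup-swapTail-punchIn j u′ k))))

swapPartner : ∀ {m} → Vec (Fin (suc (suc m))) (suc (suc m)) → Fin (suc m)
swapPartner v with head v
... | zero  = zero
... | suc j = j

involutionList-unique : ∀ m → Unique (involutionList m)
involutionList-unique zero          = All.[] ∷ []
involutionList-unique (suc zero)    = All.[] ∷ []
involutionList-unique (suc (suc m)) = Unique.++⁺
  (Unique.map⁺ fixZero-injective (involutionList-unique (suc m)))
  (Unique-concatMap⁺ _ swapPartner swapPartner-swapZero
    (λ j → Unique.map⁺ (swapZero-injective j) (involutionList-unique m)) (Unique.allFin⁺ (suc m)))
  fixed≢swapped
  where
  swapPartner-swapZero : ∀ j {v} → v ∈ map (swapZero j) (involutionList m) → swapPartner v ≡ j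
  swapPartner-swapZero j v∈ with ∈-map⁻ (swapZero j) v∈
  ... | _ , _ , refl = refl
  fixed≢swapped : ∀ {v} → v ∈ map fixZero (involutionList (suc m))
                        × v ∈ concatMap (λ j → map (swapZero j) (involutionList m)) (allFin (suc m)) → ⊥
  fixed≢swapped (v∈fixed , v∈swapped) with ∈-map⁻ fixZero v∈fixed | find (∈-concatMap⁻ _ {xs = allFin (suc m)} v∈swapped)
  ... | _ , _ , refl | j , _ , v∈ with ∈-map⁻ (swapZero j) v∈
  ... | _ , _ , ()

fixZero-preimage : ∀ {m} (t : Vec (Fin (suc m)) m) → Involutive (zero ∷ᵥ t) → ∃ λ w → Involutive w × fixZero w ≡ zero ∷ᵥ t
fixZero-preimage t inv = w , w-involutive , lookup-ext λ { zero → refl ; (suc i) → trans (lookup-fixZero w i) (sym (t≡suc-w i)) }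
  where
  v = zero ∷ᵥ t
  t≢zero : ∀ i → zero ≢ lookup t i
  t≢zero i zero≡ti with () ← trans (cong (lookup v) zero≡ti) (inv (suc i))
  w = Vec.tabulate (λ i → punchOut (t≢zero i))
  t≡suc-w : ∀ i → lookup t i ≡ suc (lookup w i)
  t≡suc-w i = trans (sym (punchIn-punchOut (t≢zero i))) (cong suc (sym (lookup∘tabulate _ i)))
  w-involutive : Involutive w
  w-involutive i = suc-injective (begin
    suc (lookup w (lookup w i)) ≡⟨ t≡suc-w (lookup w i) ⟨
    lookup v (suc (lookup w i)) ≡⟨ cong (lookup v) (t≡suc-w i) ⟨
    lookup v (lookup v (suc i)) ≡⟨ inv (suc i) ⟩
    suc i                       ∎)

swapZero-preimage : ∀ {m} (j : Fin (suc m)) (t : Vec (Fin (suc (suc m))) (suc m)) → Involutive (suc j ∷ᵥ t) →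
                    ∃ λ u → Involutive u × swapZero j u ≡ suc j ∷ᵥ t
swapZero-preimage {m} j t inv = u , u-involutive , lookup-ext λ { zero → refl ; (suc p) → agree p }
  where
  v = suc j ∷ᵥ t
  t≢zero : ∀ k → zero ≢ lookup t (punchIn j k)
  t≢zero k zero≡t = punchInᵢ≢i j k (sym (suc-injective (trans (cong (lookup v) zero≡t) (inv (suc (punchIn j k))))))
  t′ : Fin m → Fin (suc m)
  t′ k = punchOut (t≢zero k)
  j≢t′ : ∀ k → j ≢ t′ k
  j≢t′ k j≡t′ with () ← begin
    zero                                    ≡⟨ inv zero ⟨
    lookup t j                              ≡⟨ cong (lookup t) j≡t′ ⟩
    lookup t (t′ k)                         ≡⟨ cong (lookup v) (punchIn-punchOut (t≢zero k)) ⟩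
    lookup v (lookup v (suc (punchIn j k))) ≡⟨ inv (suc (punchIn j k)) ⟩
    suc (punchIn j k)                       ∎
  u = Vec.tabulate (λ k → punchOut (j≢t′ k))
  t≡ : ∀ k → lookup t (punchIn j k) ≡ suc (punchIn j (lookup u k))
  t≡ k = sym (begin
    suc (punchIn j (lookup u k))        ≡⟨ cong (suc ∘ punchIn j) (lookup∘tabulate _ k) ⟩
    suc (punchIn j (punchOut (j≢t′ k))) ≡⟨ cong suc (punchIn-punchOut (j≢t′ k)) ⟩
    suc (t′ k)                          ≡⟨ punchIn-punchOut (t≢zero k) ⟩
    lookup t (punchIn j k)              ∎)
  u-involutive : Involutive u
  u-involutive k = punchIn-injective j _ _ (suc-injective (begin
    suc (punchIn j (lookup u (lookup u k))) ≡⟨ t≡ (lookup u k) ⟨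
    lookup v (suc (punchIn j (lookup u k))) ≡⟨ cong (lookup v) (t≡ k) ⟨
    lookup v (lookup v (suc (punchIn j k))) ≡⟨ inv (suc (punchIn j k)) ⟩
    suc (punchIn j k)                       ∎))
  agree : ∀ p → lookup (swapZero j u) (suc p) ≡ lookup t p
  agree p with punchInView j p
  ... | at-j      = trans (lookup-swapTail-j j u) (sym (inv zero))
  ... | punched k = trans (lookup-swapTail-punchIn j u k) (sym (t≡ k))

involutionList-complete : ∀ m (v : Vec (Fin m) m) → Involutive v → v ∈ involutionList m
involutionList-complete zero          []ᵥ                _   = here refl
involutionList-complete (suc zero)    (zero ∷ᵥ []ᵥ)     _   = here refl
involutionList-complete (suc (suc m)) (zero ∷ᵥ t)  inv =
  let w , w-inv , fixZero-w≡ = fixZero-preimage t inv in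
  subst (_∈ involutionList (suc (suc m))) fixZero-w≡ (∈-++⁺ˡ (∈-map⁺ fixZero (involutionList-complete (suc m) w w-inv)))
involutionList-complete (suc (suc m)) (suc j ∷ᵥ t) inv =
  let u , u-inv , swapZero-u≡ = swapZero-preimage j t inv in
  subst (_∈ involutionList (suc (suc m))) swapZero-u≡ (∈-++⁺ʳ (map fixZero (involutionList (suc m)))
    (∈-concatMap⁺ _ (Any.map (λ { refl → ∈-map⁺ (swapZero j) (involutionList-complete m u u-inv) }) (∈-allFin j))))

_<ᶠ_ : ∀ {n k} → Fin n → Fin k → Bool
i <ᶠ j = toℕ i <ᵇ toℕ j

<ᶠ-irrefl : ∀ {n} (i : Fin n) → i <ᶠ i ≡ false
<ᶠ-irrefl zero    = refl
<ᶠ-irrefl (suc i) = <ᶠ-irrefl i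

punchIn-<ᶠ : ∀ {m} (j : Fin (suc m)) (k l : Fin m) → punchIn j k <ᶠ punchIn j l ≡ k <ᶠ l
punchIn-<ᶠ zero    k       l       = refl
punchIn-<ᶠ (suc j) zero    zero    = refl
punchIn-<ᶠ (suc j) zero    (suc l) = refl
punchIn-<ᶠ (suc j) (suc k) zero    = refl
punchIn-<ᶠ (suc j) (suc k) (suc l) = punchIn-<ᶠ j k l

punchIn-<ᶠ-self : ∀ {m} (j : Fin (suc m)) (k : Fin m) → punchIn j k <ᶠ j ≡ k <ᶠ j
punchIn-<ᶠ-self zero    k       = refl
punchIn-<ᶠ-self (suc j) zero    = refl
punchIn-<ᶠ-self (suc j) (suc k) = punchIn-<ᶠ-self j k

inverted : ∀ {n k} → Vec (Fin n) k → Fin k → Fin k → Bool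
inverted v i j = i <ᶠ j ∧ lookup v j <ᶠ lookup v i

oddInversions : ∀ {n k} → Vec (Fin n) k → Bool
oddInversions {k = k} v = pairParity (inverted v) (allFin k)

inversionParity≡oddInversions : ∀ {m} (v : Vec (Fin m) m) → inversionParity v ≡ oddInversions v
inversionParity≡oddInversions {m} v = parity-concatMap (λ i → map (inverted v i) (allFin m)) (allFin m)

allFin-suc : ∀ n → allFin (suc n) ≡ zero ∷ map suc (allFin n)
allFin-suc n = cong (zero ∷_) (sym (map-tabulate (λ i → i) suc))

allFin-↭-punchIn : ∀ {m} (j : Fin (suc m)) → allFin (suc m) ↭ j ∷ map (punchIn j) (allFin m)
allFin-↭-punchIn {m} j = unique∧set⇒↭ (Unique.allFin⁺ (suc m)) (j∉ ∷ Unique.map⁺ (punchIn-injective j _ _) (Unique.allFin⁺ m))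
  (mk⇔ (λ _ → from-view (punchInView j _)) (λ _ → ∈-allFin _))
  where
  j∉ : All (j ≢_) (map (punchIn j) (allFin m))
  j∉ = All.map⁺ (All.tabulate⁺ λ k j≡ → punchInᵢ≢i j k (sym j≡))
  from-view : ∀ {p} → PunchInView j p → p ∈ j ∷ map (punchIn j) (allFin m)
  from-view at-j        = here refl
  from-view (punched k) = there (∈-map⁺ (punchIn j) (∈-allFin k))

involutive⇒map-lookup-↭ : ∀ {m} (u : Vec (Fin m) m) → Involutive u → map (lookup u) (allFin m) ↭ allFin m
involutive⇒map-lookup-↭ {m} u inv = unique∧set⇒↭ (Unique.map⁺ (involutive⇒injective u inv) (Unique.allFin⁺ m)) (Unique.allFin⁺ m)
  (λ {i} → mk⇔ (λ _ → ∈-allFin i)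
    (λ _ → subst (_∈ map (lookup u) (allFin m)) (inv i) (∈-map⁺ (lookup u) (∈-allFin (lookup u i)))))

oddInversions-∷ : ∀ {n k} (x : Fin n) (t : Vec (Fin n) k) →
                  oddInversions (x ∷ᵥ t) ≡ parity (map (λ q → lookup t q <ᶠ x) (allFin k)) xor oddInversions t
oddInversions-∷ {k = k} x t = begin
  pairParity b (allFin (suc k))
    ≡⟨ cong (pairParity b) (allFin-suc k) ⟩
  pairParity b (zero ∷ map suc (allFin k))
    ≡⟨ pairParity-∷ b zero (map suc (allFin k)) ⟩
  parity (map (b zero) (map suc (allFin k))) xor (parity (map (λ i → b i zero) (map suc (allFin k))) xor pairParity b (map suc (allFin k)))
    ≡⟨ cong₂ (λ p q → p xor (q xor pairParity b (map suc (allFin k))))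
             (parity-map-∘ (b zero) suc (allFin k))
             (trans (parity-map-∘ (λ i → b i zero) suc (allFin k)) (parity-map-false (allFin k) (λ _ → refl))) ⟩
  parity (map (λ q → lookup t q <ᶠ x) (allFin k)) xor pairParity b (map suc (allFin k))
    ≡⟨ cong (parity (map (λ q → lookup t q <ᶠ x) (allFin k)) xor_) (pairParity-map suc b (allFin k)) ⟩
  parity (map (λ q → lookup t q <ᶠ x) (allFin k)) xor oddInversions t ∎
  where
  b = inverted (x ∷ᵥ t)

oddInversions-map-suc : ∀ {n k} (w : Vec (Fin n) k) → oddInversions (Vec.map suc w) ≡ oddInversions w
oddInversions-map-suc {k = k} w = pairParity-cong (allFin k) λ i j →
  cong₂ (λ p q → i <ᶠ j ∧ p <ᶠ q) (lookup-map j suc w) (lookup-map i suc w)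

oddInversions-fixZero : ∀ {m} (w : Vec (Fin m) m) → oddInversions (fixZero w) ≡ oddInversions w
oddInversions-fixZero {m} w = begin
  oddInversions (fixZero w)
    ≡⟨ oddInversions-∷ zero (Vec.map suc w) ⟩
  parity (map (λ _ → false) (allFin m)) xor oddInversions (Vec.map suc w)
    ≡⟨ cong (_xor oddInversions (Vec.map suc w)) (parity-map-false (allFin m) (λ _ → refl)) ⟩
  oddInversions (Vec.map suc w)
    ≡⟨ oddInversions-map-suc w ⟩
  oddInversions w
    ∎

xor-cancel-middle : ∀ c q → (true xor c) xor (c xor q) ≡ not q
xor-cancel-middle false q = refl
xor-cancel-middle true  q = refl

parity-swapTail-below : ∀ {m} (j : Fin (suc m)) (u : Vec (Fin m) m) → Involutive u →
                        parity (map (λ q → lookup (swapTail j u) q <ᶠ suc j) (allFin (suc m))) ≡ true xor parity (map (_<ᶠ j) (allFin m))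
parity-swapTail-below {m} j u inv = begin
  parity (map below (allFin (suc m)))
    ≡⟨ parity-↭ (map⁺ below (allFin-↭-punchIn j)) ⟩
  below j xor parity (map below (map (punchIn j) ks))
    ≡⟨ cong₂ _xor_ (cong (_<ᶠ suc j) (lookup-swapTail-j j u)) (parity-map-∘ below (punchIn j) ks) ⟩
  true xor parity (map (below ∘ punchIn j) ks)
    ≡⟨ cong (true xor_) (parity-map-cong ks λ k →
         trans (cong (_<ᶠ suc j) (lookup-swapTail-punchIn j u k)) (punchIn-<ᶠ-self j (lookup u k))) ⟩
  true xor parity (map ((_<ᶠ j) ∘ lookup u) ks)
    ≡⟨ cong (true xor_) (parity-map-∘ (_<ᶠ j) (lookup u) ks) ⟨
  true xor parity (map (_<ᶠ j) (map (lookup u) ks))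
    ≡⟨ cong (true xor_) (parity-↭ (map⁺ (_<ᶠ j) (involutive⇒map-lookup-↭ u inv))) ⟩
  true xor parity (map (_<ᶠ j) ks)
    ∎
  where
  ks = allFin m
  below : Fin (suc m) → Bool
  below q = lookup (swapTail j u) q <ᶠ suc j

oddInversions-swapTail : ∀ {m} (j : Fin (suc m)) (u : Vec (Fin m) m) →
                         oddInversions (swapTail j u) ≡ parity (map (_<ᶠ j) (allFin m)) xor oddInversions u
oddInversions-swapTail {m} j u = begin
  pairParity (inverted t) (allFin (suc m))
    ≡⟨ pairParity-↭ (inverted t) (allFin-↭-punchIn j) ⟩
  pairParity (inverted t) (j ∷ map (punchIn j) ks)
    ≡⟨ pairParity-∷ (inverted t) j (map (punchIn j) ks) ⟩
  (inverted t j j xor parity (map (inverted t j) (map (punchIn j) ks)))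
    xor (parity (map (λ i → inverted t i j) (map (punchIn j) ks)) xor pairParity (inverted t) (map (punchIn j) ks))
    ≡⟨ cong₂ _xor_ (cong₂ _xor_ diagonal row-j) (cong₂ _xor_ column-j rest) ⟩
  parity (map (_<ᶠ j) ks) xor oddInversions u
    ∎
  where
  ks = allFin m
  t = swapTail j u
  t-j : lookup t j ≡ zero
  t-j = lookup-swapTail-j j u
  t-punchIn : ∀ k → lookup t (punchIn j k) ≡ suc (punchIn j (lookup u k))
  t-punchIn = lookup-swapTail-punchIn j u
  diagonal : inverted t j j ≡ false
  diagonal = cong (_∧ (lookup t j <ᶠ lookup t j)) (<ᶠ-irrefl j)
  row-j : parity (map (inverted t j) (map (punchIn j) ks)) ≡ false
  row-j = trans (parity-map-∘ (inverted t j) (punchIn j) ks) (parity-map-false ks λ k →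
    trans (cong (λ z → j <ᶠ punchIn j k ∧ lookup t (punchIn j k) <ᶠ z) t-j) (∧-zeroʳ _))
  column-j : parity (map (λ i → inverted t i j) (map (punchIn j) ks)) ≡ parity (map (_<ᶠ j) ks)
  column-j = trans (parity-map-∘ (λ i → inverted t i j) (punchIn j) ks) (parity-map-cong ks λ k →
    trans (cong₂ (λ z w → punchIn j k <ᶠ j ∧ z <ᶠ w) t-j (t-punchIn k)) (trans (∧-identityʳ _) (punchIn-<ᶠ-self j k)))
  rest : pairParity (inverted t) (map (punchIn j) ks) ≡ oddInversions u
  rest = trans (pairParity-map (punchIn j) (inverted t) ks) (pairParity-cong ks λ k l →
    trans (cong₂ (λ z w → punchIn j k <ᶠ punchIn j l ∧ z <ᶠ w) (t-punchIn l) (t-punchIn k))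
          (cong₂ _∧_ (punchIn-<ᶠ j k l) (punchIn-<ᶠ j (lookup u l) (lookup u k))))

-- Besides the inversions of u, swapZero j u has the inversion (0 , suc j), an inversion (0 , suc (punchIn j k))
-- for each k with u k < j, and an inversion (suc (punchIn j k) , suc j) for each k < j; the last two
-- counts are equal because u is a bijection.
oddInversions-swapZero : ∀ {m} (j : Fin (suc m)) (u : Vec (Fin m) m) → Involutive u →
                         oddInversions (swapZero j u) ≡ not (oddInversions u)
oddInversions-swapZero {m} j u inv = begin
  oddInversions (swapZero j u)
    ≡⟨ oddInversions-∷ (suc j) (swapTail j u) ⟩
  parity (map (λ q → lookup (swapTail j u) q <ᶠ suc j) (allFin (suc m))) xor oddInversions (swapTail j u)
    ≡⟨ cong₂ _xor_ (parity-swapTail-below j u inv) (oddInversions-swapTail j u) ⟩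
  (true xor below-j) xor (below-j xor oddInversions u)
    ≡⟨ xor-cancel-middle below-j (oddInversions u) ⟩
  not (oddInversions u)
    ∎
  where
  below-j = parity (map (_<ᶠ j) (allFin m))


isEven-fixZero : ∀ {m} (w : Vec (Fin m) m) → isEven (fixZero w) ≡ isEven w
isEven-fixZero w = cong not (begin
  inversionParity (fixZero w) ≡⟨ inversionParity≡oddInversions (fixZero w) ⟩
  oddInversions (fixZero w)   ≡⟨ oddInversions-fixZero w ⟩
  oddInversions w             ≡⟨ inversionParity≡oddInversions w ⟨
  inversionParity w           ∎)

isEven-swapZero : ∀ {m} (j : Fin (suc m)) (u : Vec (Fin m) m) → Involutive u → isEven (swapZero j u) ≡ not (isEven u)
isEven-swapZero j u inv = cong not (begin
  inversionParity (swapZero j u) ≡⟨ inversionParity≡oddInversions (swapZero j u) ⟩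
  oddInversions (swapZero j u)   ≡⟨ oddInversions-swapZero j u inv ⟩
  not (oddInversions u)          ≡⟨ cong not (inversionParity≡oddInversions u) ⟨
  not (inversionParity u)        ∎)

length-filterᵇ-involutionList :
  ∀ m (p : Vec (Fin (suc (suc m))) (suc (suc m)) → Bool) (r : Vec (Fin m) m → Bool) →
  (∀ j u → Involutive u → p (swapZero j u) ≡ r u) →
  length (filterᵇ p (involutionList (suc (suc m)))) ≡
  length (filterᵇ (p ∘ fixZero) (involutionList (suc m))) + suc m * length (filterᵇ r (involutionList m))
length-filterᵇ-involutionList m p r p≡r = begin
  length (filterᵇ p (map fixZero (involutionList (suc m)) ++ concatMap swaps (allFin (suc m))))
    ≡⟨ cong length (filter-++ (T? ∘ p) (map fixZero (involutionList (suc m))) _) ⟩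
  length (filterᵇ p (map fixZero (involutionList (suc m))) ++ filterᵇ p (concatMap swaps (allFin (suc m))))
    ≡⟨ length-++ (filterᵇ p (map fixZero (involutionList (suc m)))) ⟩
  length (filterᵇ p (map fixZero (involutionList (suc m)))) + length (filterᵇ p (concatMap swaps (allFin (suc m))))
    ≡⟨ cong₂ _+_ (length-filterᵇ-map p fixZero (involutionList (suc m))) (length-filterᵇ-concatMap p swaps (allFin (suc m)) swaps-count) ⟩
  length (filterᵇ (p ∘ fixZero) (involutionList (suc m))) + length (allFin (suc m)) * length (filterᵇ r (involutionList m))
    ≡⟨ cong (λ n → length (filterᵇ (p ∘ fixZero) (involutionList (suc m))) + n * length (filterᵇ r (involutionList m)))
            (length-tabulate {n = suc m} (λ i → i)) ⟩
  length (filterᵇ (p ∘ fixZero) (involutionList (suc m))) + suc m * length (filterᵇ r (involutionList m))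
    ∎
  where
  swaps : Fin (suc m) → List (Vec (Fin (suc (suc m))) (suc (suc m)))
  swaps j = map (swapZero j) (involutionList m)
  swaps-count : ∀ j → length (filterᵇ p (swaps j)) ≡ length (filterᵇ r (involutionList m))
  swaps-count j = trans (length-filterᵇ-map p (swapZero j) (involutionList m))
    (cong length (filterᵇ-cong (involutionList m) λ u∈ → p≡r j _ (All.lookup (involutionList-involutive m) u∈)))

evenInvolutions oddInvolutions : ℕ → ℕ
evenInvolutions zero          = 1
evenInvolutions (suc zero)    = 1
evenInvolutions (suc (suc m)) = evenInvolutions (suc m) + suc m * oddInvolutions m
oddInvolutions zero          = 0
oddInvolutions (suc zero)    = 0
oddInvolutions (suc (suc m)) = oddInvolutions (suc m) + suc m * evenInvolutions m

involutionList-parity-counts : ∀ m → length (filterᵇ isEven (involutionList m)) ≡ evenInvolutions m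
                                   × length (filterᵇ (not ∘ isEven) (involutionList m)) ≡ oddInvolutions m
involutionList-parity-counts zero       = refl , refl
involutionList-parity-counts (suc zero) = refl , refl
involutionList-parity-counts (suc (suc m)) =
  let even₁ , odd₁ = involutionList-parity-counts (suc m)
      even₀ , odd₀ = involutionList-parity-counts m in
  trans (length-filterᵇ-involutionList m isEven (not ∘ isEven) isEven-swapZero)
        (cong₂ (λ n k → n + suc m * k) (trans (cong length (filterᵇ-cong L λ {w} _ → isEven-fixZero w)) even₁) odd₀) ,
  trans (length-filterᵇ-involutionList m (not ∘ isEven) isEven odd-swapZero)
        (cong₂ (λ n k → n + suc m * k) (trans (cong length (filterᵇ-cong L λ {w} _ → cong not (isEven-fixZero w))) odd₁) even₀)
  where
  L = involutionList (suc m)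
  odd-swapZero : ∀ j u → Involutive u → not (isEven (swapZero j u)) ≡ isEven u
  odd-swapZero j u inv = trans (cong not (isEven-swapZero j u inv)) (not-involutive _)

-- From m = 8 on, the recurrences only add multiples of 4 to (evenInvolutions 8 , oddInvolutions 8) = (316 , 448)
-- and (evenInvolutions 9 , oddInvolutions 9) = (1324 , 1296).
4∣involutionCounts : ∀ n → (4 ∣ evenInvolutions (8 + n) × 4 ∣ oddInvolutions (8 + n))
                         × (4 ∣ evenInvolutions (9 + n) × 4 ∣ oddInvolutions (9 + n))
4∣involutionCounts zero    = (divides 79 refl , divides 112 refl) , (divides 331 refl , divides 324 refl)
4∣involutionCounts (suc n) =
  let (4∣e₀ , 4∣o₀) , (4∣e₁ , 4∣o₁) = 4∣involutionCounts n in
  (4∣e₁ , 4∣o₁) , (∣m∣n⇒∣m+n 4∣e₁ (∣n⇒∣m*n (9 + n) 4∣o₀) , ∣m∣n⇒∣m+n 4∣o₁ (∣n⇒∣m*n (9 + n) 4∣e₀))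

∈-involutions-Sym⇔ : ∀ m {v} → v ∈ filterᵇ isInvolution (Sym m) ⇔ v ∈ involutionList m
∈-involutions-Sym⇔ m {v} = mk⇔
  (λ v∈ → involutionList-complete m v (Equivalence.to (isInvolution⇔ v) (proj₂ (∈-filter⁻ (T? ∘ isInvolution) {xs = Sym m} v∈))))
  (λ v∈ → let inv = All.lookup (involutionList-involutive m) v∈ in
    ∈-filter⁺ (T? ∘ isInvolution) (∈-filter⁺ (T? ∘ isPerm) (allVecs-complete m m v) (involutive⇒isPerm v inv))
              (Equivalence.from (isInvolution⇔ v) inv))

∈-involutions-Alt⇔ : ∀ m {v} → v ∈ filterᵇ isInvolution (Alt m) ⇔ v ∈ filterᵇ isEven (involutionList m)
∈-involutions-Alt⇔ m {v} = mk⇔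
  (λ v∈ → let v∈Alt , involution = ∈-filter⁻ (T? ∘ isInvolution) {xs = Alt m} v∈
              v∈Sym , even       = ∈-filter⁻ (T? ∘ isEven) {xs = Sym m} v∈Alt in
    ∈-filter⁺ (T? ∘ isEven) (Equivalence.to (∈-involutions-Sym⇔ m) (∈-filter⁺ (T? ∘ isInvolution) v∈Sym involution)) even)
  (λ v∈ → let v∈list , even     = ∈-filter⁻ (T? ∘ isEven) {xs = involutionList m} v∈
              v∈Sym , involution = ∈-filter⁻ (T? ∘ isInvolution) {xs = Sym m} (Equivalence.from (∈-involutions-Sym⇔ m) v∈list) in
    ∈-filter⁺ (T? ∘ isInvolution) (∈-filter⁺ (T? ∘ isEven) v∈Sym even) involution)

Sym-unique : ∀ m → Unique (Sym m)
Sym-unique m = Unique.filter⁺ (T? ∘ isPerm) (allVecs-unique m m)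

involutionsS≡ : ∀ m → involutionsS m ≡ evenInvolutions m + oddInvolutions m
involutionsS≡ m = begin
  involutionsS m
    ≡⟨ unique∧set⇒length≡ (Unique.filter⁺ (T? ∘ isInvolution) (Sym-unique m)) (involutionList-unique m) (∈-involutions-Sym⇔ m) ⟩
  length (involutionList m)
    ≡⟨ length-filterᵇ-partition isEven (involutionList m) ⟩
  length (filterᵇ isEven (involutionList m)) + length (filterᵇ (not ∘ isEven) (involutionList m))
    ≡⟨ cong₂ _+_ (proj₁ (involutionList-parity-counts m)) (proj₂ (involutionList-parity-counts m)) ⟩
  evenInvolutions m + oddInvolutions m
    ∎

involutionsA≡ : ∀ m → involutionsA m ≡ evenInvolutions m
involutionsA≡ m = begin
  involutionsA m
    ≡⟨ unique∧set⇒length≡ (Unique.filter⁺ (T? ∘ isInvolution) (Unique.filter⁺ (T? ∘ isEven) (Sym-unique m)))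
                     (Unique.filter⁺ (T? ∘ isEven) (involutionList-unique m)) (∈-involutions-Alt⇔ m) ⟩
  length (filterᵇ isEven (involutionList m))
    ≡⟨ proj₁ (involutionList-parity-counts m) ⟩
  evenInvolutions m
    ∎

proposition2p2 : (m : ℕ) → 8 ≤ m → (4 ∣ involutionsA m) × (4 ∣ involutionsS m)
proposition2p2 m 8≤m with m≤n⇒∃[o]m+o≡n 8≤m
... | n , refl =
  let (4∣even , 4∣odd) , _ = 4∣involutionCounts n in
  subst (4 ∣_) (sym (involutionsA≡ (8 + n))) 4∣even ,
  subst (4 ∣_) (sym (involutionsS≡ (8 + n))) (∣m∣n⇒∣m+n 4∣even 4∣odd)
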